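{- Let $G=\langle s_1,\dots,s_k\mid r_1,\dots,r_m\rangle\cong F_k/R$, where $F_k$ is free on $s_1,\dots,s_k$ and $R$ is the normal closure of $r_1,\dots,r_m$. Let $E^1,E^2$ be groups with a common normal subgroup $N$ and identifications $E^j/N\cong G$ ($j=1,2$), and let $\hat s^j_i\in E^j$ be lifts of $Rs_i$ ($i=1,\dots,k$). Suppose the induced actions on $N$ agree: $a^{\hat s^1_i}=a^{\hat s^2_i}$ for all $a\in N$ and all $i$. Then $\varphi_{E^1}=\varphi_{E^2}$ if and only if there is an isomorphism $g:E^1\to E^2$ with $g\upharpoonright N=\mathrm{id}_N$ and $g(\hat s^1_i)=\hat s^2_i$ for $i=1,\dots,k$.
   Context: For an extension $E$ of $N$ by $G$ (a group $E$ containing $N$ as normal subgroup with $E/N\cong G$) with chosen lifts $\hat s_1,\dots,\hat s_k\in E$ of $Rs_1,\dots,Rs_k$ (i.e. $\hat s_i$ maps to $Rs_i$ under the projection), the map $\varphi_E:R\to N$ is defined by $w(s_1,\dots,s_k)\mapsto w(\hat s_1,\dots,\hat s_k)$ for words $w(s_1,\dots,s_k)\in R$. $a^{h}$ denotes conjugation $h^{ -1}ah$. -}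

module Defs where

open import Level using (Level; _⊔_; suc)
open import Data.Nat using (ℕ)
open import Data.Fin using (Fin)
open import Data.Bool using (Bool; true; false; not)
open import Data.Product using (Σ; _×_; _,_; ∃)
open import Data.List using (List; []; _∷_; _++_; map; reverse; [_])
open import Function.Bundles using (_⇔_)
open import Algebra.Bundles using (Group)
open import Algebra.Morphism.Structures using (module GroupMorphisms)

-- The free group F_k on s_1..s_k, as words modulo free reduction

-- a letter (i , true) is s_i, (i , false) is s_i⁻¹
Letter : ℕ → Set
Letter k = Fin k × Bool

Word : ℕ → Set
Word k = List (Letter k)

invLetter : ∀ {k} → Letter k → Letter k
invLetter (i , b) = (i , not b)

invW : ∀ {k} → Word k → Word k
invW w = reverse (map invLetter w)

-- equality in F_k: equivalence closure of cancelling x x⁻¹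
data _~_ {k : ℕ} : Word k → Word k → Set where
  ~-refl   : ∀ {u} → u ~ u
  ~-sym    : ∀ {u v} → u ~ v → v ~ u
  ~-trans  : ∀ {u v w} → u ~ v → v ~ w → u ~ w
  ~-cancel : ∀ u x v → (u ++ x ∷ invLetter x ∷ v) ~ (u ++ v)

-- R = normal closure in F_k of the relators r_1..r_m

data InR {k m : ℕ} (r : Fin m → Word k) : Word k → Set where
  R-gen  : ∀ j → InR r (r j)
  R-one  : InR r []
  R-mul  : ∀ {u v} → InR r u → InR r v → InR r (u ++ v)
  R-inv  : ∀ {u} → InR r u → InR r (invW u)
  R-conj : ∀ g {u} → InR r u → InR r (invW g ++ u ++ g)
  R-resp : ∀ {u v} → u ~ v → InR r u → InR r v

-- equality in G = F_k / R : cosets Ru = Rv iff u v⁻¹ ∈ R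
-- (equivalently u⁻¹ v ∈ R, R being normal)
_≈G[_]_ : ∀ {k m} → Word k → (Fin m → Word k) → Word k → Set
u ≈G[ r ] v = InR r (u ++ invW v)

-- N is given abstractly and embedded into E as a normal subgroup by ι;
-- the identification E/N ≅ G is given (first isomorphism theorem) by a
-- surjective homomorphism π : E → G = F_k/R whose kernel is exactly ι(N).

record Extension {c ℓ : Level} {k m : ℕ} (r : Fin m → Word k)
                 (N : Group c ℓ) : Set (suc (c ⊔ ℓ)) where
  field
    E : Group c ℓ
  open Group E
  open Group N using () renaming (Carrier to NC)
  field
    ι         : NC → Carrier
    ι-mono    : GroupMorphisms.IsGroupMonomorphism (Group.rawGroup N) rawGroup ι
    ι-normal  : ∀ (e : Carrier) (a : NC) → ∃ λ b → ι b ≈ e ⁻¹ ∙ ι a ∙ e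
    π         : Carrier → Word k
    π-cong    : ∀ {x y} → x ≈ y → π x ≈G[ r ] π y
    π-hom     : ∀ x y → π (x ∙ y) ≈G[ r ] (π x ++ π y)
    π-surj    : ∀ (w : Word k) → ∃ λ x → π x ≈G[ r ] w
    π-kernel  : ∀ (x : Carrier) → (π x ≈G[ r ] []) ⇔ (∃ λ a → ι a ≈ x)
    lift      : Fin k → Carrier
    lift-proj : ∀ i → π (lift i) ≈G[ r ] [ (i , true) ]

  evalLetter : Letter k → Carrier
  evalLetter (i , true)  = lift i
  evalLetter (i , false) = lift i ⁻¹

  eval : Word k → Carrier
  eval []       = ε
  eval (x ∷ w)  = evalLetter x ∙ eval w

  -- graph of φ_E : R → N :  φ_E(w) = a  iff  ι a = w(ŝ)
  φ-graph : Word k → NC → Set ℓ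
  φ-graph w a = ι a ≈ eval w

  -- graph of the action of ŝ_i on N :  a^{ŝ_i} = b  iff  ι b = ŝ_i⁻¹ ι a ŝ_i
  act-graph : Fin k → NC → NC → Set ℓ
  act-graph i a b = ι b ≈ lift i ⁻¹ ∙ ι a ∙ lift i

module _ {c ℓ : Level} {k m : ℕ} {r : Fin m → Word k} {N : Group c ℓ}
         (X₁ X₂ : Extension r N) where
  private
    module X₁ = Extension X₁
    module X₂ = Extension X₂
    module E₁ = Group X₁.E
    module E₂ = Group X₂.E

  SameAction : Set (c ⊔ ℓ)
  SameAction = ∀ i a b → X₁.act-graph i a b ⇔ X₂.act-graph i a b

  SamePhi : Set (c ⊔ ℓ)
  SamePhi = ∀ w → InR r w → ∀ a → X₁.φ-graph w a ⇔ X₂.φ-graph w a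

  IsoFixingNAndLifts : Set (c ⊔ ℓ)
  IsoFixingNAndLifts =
    Σ (E₁.Carrier → E₂.Carrier) λ g →
      GroupMorphisms.IsGroupIsomorphism E₁.rawGroup E₂.rawGroup g
      × (∀ a → g (X₁.ι a) E₂.≈ X₂.ι a)
      × (∀ i → g (X₁.lift i) E₂.≈ X₂.lift i)

module Submission where

-- Every x ∈ E has a normal form x = ι(a) · w(ŝ) with w = π x, and two normal forms
-- ι(a) w(ŝ), ι(b) v(ŝ) are equal iff φ_E(v w⁻¹) = b⁻¹ a.  Hence if φ_{E¹} = φ_{E²}
-- the map g : ι(a) w(ŝ¹) ↦ ι(a) w(ŝ²) is well defined and injective; it is
-- multiplicative because commuting ι(b) past u(ŝ) conjugates it by u(ŝ), which
-- (being a product of the ŝ_i^{±1}) acts on N in the same way in both extensions.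
-- Conversely an isomorphism fixing N and the ŝ_i fixes every w(ŝ), hence φ.

open import Defs
open import Level using (Level)
open import Data.Nat using (ℕ)
open import Data.Fin using (Fin)
open import Data.Bool using (true; false)
open import Data.Bool.Properties using (not-involutive)
open import Data.Product using (Σ; _,_; ∃; proj₁; proj₂)
open import Data.List using ([]; _∷_; _++_; map; reverse; [_])
open import Data.List.Properties using (++-assoc; ++-identityʳ; map-++; reverse-++; unfold-reverse)
import Relation.Binary.PropositionalEquality as ≡
open import Function.Bundles using (_⇔_; mk⇔; Equivalence)
open import Algebra.Bundles using (Group)
open import Algebra.Morphism.Structures using (module GroupMorphisms)
import Algebra.Properties.Group as GroupProperties
import Relation.Binary.Reasoning.Setoid as SetoidReasoning

module FreeWords {k : ℕ} where
  open ≡ using (_≡_; refl; sym; trans; cong; cong₂; subst)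
  open ≡.≡-Reasoning

  invLetter-involutive : (x : Letter k) → invLetter (invLetter x) ≡ x
  invLetter-involutive (i , b) = cong (i ,_) (not-involutive b)

  invW-∷ : (x : Letter k) (w : Word k) → invW (x ∷ w) ≡ invW w ++ [ invLetter x ]
  invW-∷ x w = unfold-reverse (invLetter x) (map invLetter w)

  invW-++ : (u v : Word k) → invW (u ++ v) ≡ invW v ++ invW u
  invW-++ u v = trans (cong reverse (map-++ invLetter u v)) (reverse-++ (map invLetter u) (map invLetter v))

  invW-involutive : (w : Word k) → invW (invW w) ≡ w
  invW-involutive [] = refl
  invW-involutive (x ∷ w) = begin
    invW (invW (x ∷ w))               ≡⟨ cong invW (invW-∷ x w) ⟩
    invW (invW w ++ [ invLetter x ])  ≡⟨ invW-++ (invW w) [ invLetter x ] ⟩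
    invLetter (invLetter x) ∷ invW (invW w)
                                      ≡⟨ cong₂ _∷_ (invLetter-involutive x) (invW-involutive w) ⟩
    x ∷ w                             ∎

  ≡⇒~ : {u v : Word k} → u ≡ v → u ~ v
  ≡⇒~ refl = ~-refl

  ~-cong : {u v : Word k} (p q : Word k) → u ~ v → (p ++ u ++ q) ~ (p ++ v ++ q)
  ~-cong p q ~-refl          = ~-refl
  ~-cong p q (~-sym h)       = ~-sym (~-cong p q h)
  ~-cong p q (~-trans h h′)  = ~-trans (~-cong p q h) (~-cong p q h′)
  ~-cong p q (~-cancel u x v) =
    ~-trans (≡⇒~ (regroup (x ∷ invLetter x ∷ v)))
            (~-trans (~-cancel (p ++ u) x (v ++ q)) (≡⇒~ (sym (regroup v))))
    where
      regroup : ∀ t → p ++ (u ++ t) ++ q ≡ (p ++ u) ++ (t ++ q)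
      regroup t = trans (cong (p ++_) (++-assoc u t q)) (sym (++-assoc p u (t ++ q)))

  invW-inverseʳ : (u : Word k) → (u ++ invW u) ~ []
  invW-inverseʳ [] = ~-refl
  invW-inverseʳ (x ∷ u) =
    ~-trans (≡⇒~ regroup) (~-trans (~-cong [ x ] [ invLetter x ] (invW-inverseʳ u)) (~-cancel [] x []))
    where
      regroup : (x ∷ u) ++ invW (x ∷ u) ≡ [ x ] ++ (u ++ invW u) ++ [ invLetter x ]
      regroup = cong (x ∷_) (trans (cong (u ++_) (invW-∷ x u)) (sym (++-assoc u (invW u) _)))

  invW-inverseˡ : (u : Word k) → (invW u ++ u) ~ []
  invW-inverseˡ u = subst (λ v → (invW u ++ v) ~ []) (invW-involutive u) (invW-inverseʳ (invW u))

module Presentation {k m : ℕ} (r : Fin m → Word k) where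
  open FreeWords {k}
  open ≡ using (_≡_; sym; trans; cong; subst)

  -- Ru = Rv.  The record wrapper lets Agda infer u and v, which cannot be
  -- recovered from the underlying proposition InR r (u ++ invW v).
  infix 4 _≈ᴳ_
  record _≈ᴳ_ (u v : Word k) : Set where
    constructor coset-eq
    field relator : u ≈G[ r ] v
  open _≈ᴳ_ public

  ~⇒≈ᴳ : ∀ {u v} → u ~ v → u ≈ᴳ v
  ~⇒≈ᴳ {u} {v} h =
    coset-eq (R-resp (~-trans (~-sym (invW-inverseʳ v)) (~-cong [] (invW v) (~-sym h))) R-one)

  ≈ᴳ-sym : ∀ {u v} → u ≈ᴳ v → v ≈ᴳ u
  ≈ᴳ-sym {u} {v} (coset-eq h) = coset-eq (subst (InR r) inverse (R-inv h))
    where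
      inverse : invW (u ++ invW v) ≡ v ++ invW u
      inverse = trans (invW-++ u (invW v)) (cong (_++ invW u) (invW-involutive v))

  ≈ᴳ-trans : ∀ {u v w} → u ≈ᴳ v → v ≈ᴳ w → u ≈ᴳ w
  ≈ᴳ-trans {u} {v} {w} (coset-eq h) (coset-eq h′) =
    coset-eq (R-resp (~-trans (≡⇒~ regroup) (~-cong u (invW w) (invW-inverseˡ v))) (R-mul h h′))
    where
      regroup : (u ++ invW v) ++ (v ++ invW w) ≡ u ++ (invW v ++ v) ++ invW w
      regroup = trans (++-assoc u (invW v) _) (cong (u ++_) (sym (++-assoc (invW v) v _)))

  -- Right multiplication: (u v)(u′ v)⁻¹ = u u′⁻¹ in F_k.
  ≈ᴳ-congʳ : ∀ {u u′} v → u ≈ᴳ u′ → (u ++ v) ≈ᴳ (u′ ++ v)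
  ≈ᴳ-congʳ {u} {u′} v (coset-eq h) =
    coset-eq (R-resp (~-sym (~-trans (≡⇒~ regroup) (~-cong u (invW u′) (invW-inverseʳ v)))) h)
    where
      regroup : (u ++ v) ++ invW (u′ ++ v) ≡ u ++ (v ++ invW v) ++ invW u′
      regroup = trans (++-assoc u v _) (cong (u ++_) (trans (cong (v ++_) (invW-++ u′ v))
                  (sym (++-assoc v (invW v) (invW u′)))))

  -- Left multiplication: (u v)(u v′)⁻¹ is the conjugate of v v′⁻¹ by u⁻¹.
  ≈ᴳ-congˡ : ∀ u {v v′} → v ≈ᴳ v′ → (u ++ v) ≈ᴳ (u ++ v′)
  ≈ᴳ-congˡ u {v} {v′} (coset-eq h) = coset-eq (subst (InR r) conjugate (R-conj (invW u) h))
    where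
      conjugate : invW (invW u) ++ (v ++ invW v′) ++ invW u ≡ (u ++ v) ++ invW (u ++ v′)
      conjugate = trans (cong (_++ (v ++ invW v′) ++ invW u) (invW-involutive u))
        (trans (cong (u ++_) (++-assoc v (invW v′) (invW u)))
          (trans (sym (++-assoc u v _)) (cong ((u ++ v) ++_) (sym (invW-++ u v′)))))

  ≈ᴳ-++ : ∀ {u u′ v v′} → u ≈ᴳ u′ → v ≈ᴳ v′ → (u ++ v) ≈ᴳ (u′ ++ v′)
  ≈ᴳ-++ {u′ = u′} {v = v} hu hv = ≈ᴳ-trans (≈ᴳ-congʳ v hu) (≈ᴳ-congˡ u′ hv)

  ≈ᴳ-moveʳ : ∀ {u v w} → (u ++ v) ≈ᴳ w → u ≈ᴳ (w ++ invW v)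
  ≈ᴳ-moveʳ {u} {v} {w} h = ≈ᴳ-trans (~⇒≈ᴳ cancel) (≈ᴳ-congʳ (invW v) h)
    where
      cancel : u ~ ((u ++ v) ++ invW v)
      cancel = ~-sym (~-trans (≡⇒~ (trans (++-assoc u v _) (cong (u ++_) (sym (++-identityʳ _)))))
                 (~-trans (~-cong u [] (invW-inverseʳ v)) (≡⇒~ (++-identityʳ u))))

  ≈ᴳ-invW : ∀ {u v} → u ≈ᴳ v → invW u ≈ᴳ invW v
  ≈ᴳ-invW {u} {v} h =
    ≈ᴳ-moveʳ (≈ᴳ-trans (≈ᴳ-congˡ (invW u) (≈ᴳ-sym h)) (~⇒≈ᴳ (invW-inverseˡ u)))

  ≈ᴳ-[]⇒InR : ∀ {u} → u ≈ᴳ [] → InR r u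
  ≈ᴳ-[]⇒InR {u} (coset-eq h) = subst (InR r) (++-identityʳ u) h

module GroupFacts {c ℓ : Level} (G : Group c ℓ) where
  open Group G
  open GroupProperties G public using (ε⁻¹≈ε; ⁻¹-involutive; ⁻¹-anti-homo-∙; inverseˡ-unique; //-rightDividesˡ)
  open GroupProperties G using (\\-leftDividesˡ; \\-leftDividesʳ; //-rightDividesʳ)
  open SetoidReasoning setoid

  ∙-cancelʳ : ∀ {x y} z → x ∙ z ≈ y ∙ z → x ≈ y
  ∙-cancelʳ {x} {y} z h = begin
    x             ≈⟨ //-rightDividesʳ z x ⟨
    x ∙ z ∙ z ⁻¹  ≈⟨ ∙-congʳ h ⟩
    y ∙ z ∙ z ⁻¹  ≈⟨ //-rightDividesʳ z y ⟩
    y             ∎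

  cross-divide : ∀ {x y z t} → x ∙ y ≈ z ∙ t → z ⁻¹ ∙ x ≈ t ∙ y ⁻¹
  cross-divide {x} {y} {z} {t} h = begin
    z ⁻¹ ∙ x                ≈⟨ //-rightDividesʳ y (z ⁻¹ ∙ x) ⟨
    z ⁻¹ ∙ x ∙ y ∙ y ⁻¹     ≈⟨ ∙-congʳ (assoc _ _ _) ⟩
    z ⁻¹ ∙ (x ∙ y) ∙ y ⁻¹   ≈⟨ ∙-congʳ (∙-congˡ h) ⟩
    z ⁻¹ ∙ (z ∙ t) ∙ y ⁻¹   ≈⟨ ∙-congʳ (\\-leftDividesʳ z t) ⟩
    t ∙ y ⁻¹                ∎

  cross-multiply : ∀ {x y z t} → z ⁻¹ ∙ x ≈ t ∙ y ⁻¹ → x ∙ y ≈ z ∙ t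
  cross-multiply {x} {y} {z} {t} h = ∙-cancelʳ (y ⁻¹) (begin
    x ∙ y ∙ y ⁻¹            ≈⟨ //-rightDividesʳ y x ⟩
    x                       ≈⟨ \\-leftDividesˡ z x ⟨
    z ∙ (z ⁻¹ ∙ x)          ≈⟨ ∙-congˡ h ⟩
    z ∙ (t ∙ y ⁻¹)          ≈⟨ assoc z t (y ⁻¹) ⟨
    z ∙ t ∙ y ⁻¹            ∎)

  -- Conjugate e z y says y = e z e⁻¹, stated without inverses.
  Conjugate : Carrier → Carrier → Carrier → Set ℓ
  Conjugate e z y = y ∙ e ≈ e ∙ z

  conjugate-ε⇒≈ : ∀ {z y} → Conjugate ε z y → y ≈ z
  conjugate-ε⇒≈ {z} {y} h = trans (sym (identityʳ y)) (trans h (identityˡ z))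

  ≈⇒conjugate-ε : ∀ {z y} → y ≈ z → Conjugate ε z y
  ≈⇒conjugate-ε {z} {y} h = trans (identityʳ y) (trans h (sym (identityˡ z)))

  conjugate-cong : ∀ {e e′ z y} → e ≈ e′ → Conjugate e z y → Conjugate e′ z y
  conjugate-cong e≈e′ h = trans (∙-congˡ (sym e≈e′)) (trans h (∙-congʳ e≈e′))

  conjugate-∙ : ∀ {e f z z′ y} → Conjugate e z′ y → Conjugate f z z′ → Conjugate (e ∙ f) z y
  conjugate-∙ {e} {f} {z} {z′} {y} he hf = begin
    y ∙ (e ∙ f)   ≈⟨ assoc y e f ⟨
    y ∙ e ∙ f     ≈⟨ ∙-congʳ he ⟩
    e ∙ z′ ∙ f    ≈⟨ assoc e z′ f ⟩
    e ∙ (z′ ∙ f)  ≈⟨ ∙-congˡ hf ⟩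
    e ∙ (f ∙ z)   ≈⟨ assoc e f z ⟨
    e ∙ f ∙ z     ∎

  conjugate-splitˡ : ∀ {e f z z′ y} → Conjugate (e ∙ f) z y → Conjugate f z z′ → Conjugate e z′ y
  conjugate-splitˡ {e} {f} {z} {z′} {y} hef hf = ∙-cancelʳ f (begin
    y ∙ e ∙ f     ≈⟨ assoc y e f ⟩
    y ∙ (e ∙ f)   ≈⟨ hef ⟩
    e ∙ f ∙ z     ≈⟨ assoc e f z ⟩
    e ∙ (f ∙ z)   ≈⟨ ∙-congˡ hf ⟨
    e ∙ (z′ ∙ f)  ≈⟨ assoc e z′ f ⟨
    e ∙ z′ ∙ f    ∎)

  conjugate-⁻¹ : ∀ {e z y} → Conjugate e z y → Conjugate (e ⁻¹) y z
  conjugate-⁻¹ {e} {z} {y} h = begin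
    z ∙ e ⁻¹               ≈⟨ ∙-congʳ (\\-leftDividesʳ e z) ⟨
    e ⁻¹ ∙ (e ∙ z) ∙ e ⁻¹  ≈⟨ ∙-congʳ (∙-congˡ h) ⟨
    e ⁻¹ ∙ (y ∙ e) ∙ e ⁻¹  ≈⟨ assoc (e ⁻¹) (y ∙ e) (e ⁻¹) ⟩
    e ⁻¹ ∙ (y ∙ e ∙ e ⁻¹)  ≈⟨ ∙-congˡ (//-rightDividesʳ e y) ⟩
    e ⁻¹ ∙ y               ∎

  conjugate-by-⁻¹ : ∀ {e z y} → Conjugate (e ⁻¹) z y → Conjugate e y z
  conjugate-by-⁻¹ h = conjugate-cong (⁻¹-involutive _) (conjugate-⁻¹ h)

  -- The form y = e⁻¹ z e used in the definitions of normality and of the action.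
  conjugate⁻¹-form→ : ∀ {e z y} → y ≈ e ⁻¹ ∙ z ∙ e → Conjugate e y z
  conjugate⁻¹-form→ {e} {z} {y} h = begin
    z ∙ e              ≈⟨ \\-leftDividesˡ e (z ∙ e) ⟨
    e ∙ (e ⁻¹ ∙ (z ∙ e)) ≈⟨ ∙-congˡ (trans (sym (assoc (e ⁻¹) z e)) (sym h)) ⟩
    e ∙ y              ∎

  conjugate⁻¹-form← : ∀ {e z y} → Conjugate e y z → y ≈ e ⁻¹ ∙ z ∙ e
  conjugate⁻¹-form← {e} {z} {y} h = begin
    y                  ≈⟨ \\-leftDividesʳ e y ⟨
    e ⁻¹ ∙ (e ∙ y)     ≈⟨ ∙-congˡ h ⟨
    e ⁻¹ ∙ (z ∙ e)     ≈⟨ assoc (e ⁻¹) z e ⟨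
    e ⁻¹ ∙ z ∙ e       ∎

  conjugate-slide : ∀ {e z y} a b → Conjugate e z y → a ∙ e ∙ (z ∙ b) ≈ a ∙ y ∙ (e ∙ b)
  conjugate-slide {e} {z} {y} a b h = begin
    a ∙ e ∙ (z ∙ b)    ≈⟨ assoc a e (z ∙ b) ⟩
    a ∙ (e ∙ (z ∙ b))  ≈⟨ ∙-congˡ (assoc e z b) ⟨
    a ∙ (e ∙ z ∙ b)    ≈⟨ ∙-congˡ (∙-congʳ h) ⟨
    a ∙ (y ∙ e ∙ b)    ≈⟨ ∙-congˡ (assoc y e b) ⟩
    a ∙ (y ∙ (e ∙ b))  ≈⟨ assoc a y (e ∙ b) ⟨
    a ∙ y ∙ (e ∙ b)    ∎

module _ {c₁ ℓ₁ c₂ ℓ₂ : Level} (G : Group c₁ ℓ₁) (H : Group c₂ ℓ₂) where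
  private
    module G = Group G
    module H = Group H
    module HF = GroupFacts H

  multiplicative⇒isGroupHomomorphism :
    (f : G.Carrier → H.Carrier) →
    (∀ {x y} → x G.≈ y → f x H.≈ f y) →
    (∀ x y → f (x G.∙ y) H.≈ f x H.∙ f y) →
    GroupMorphisms.IsGroupHomomorphism G.rawGroup H.rawGroup f
  multiplicative⇒isGroupHomomorphism f f-cong f-∙ = record
    { isMonoidHomomorphism = record
      { isMagmaHomomorphism = record
        { isRelHomomorphism = record { cong = f-cong }
        ; homo = f-∙ }
      ; ε-homo = f-ε }
    ; ⁻¹-homo = f-⁻¹ }
    where
      f-ε : f G.ε H.≈ H.ε
      f-ε = HF.∙-cancelʳ (f G.ε)
              (H.trans (H.sym (f-∙ G.ε G.ε)) (H.trans (f-cong (G.identityˡ G.ε)) (H.sym (H.identityˡ _))))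
      f-⁻¹ : ∀ x → f (x G.⁻¹) H.≈ f x H.⁻¹
      f-⁻¹ x = HF.inverseˡ-unique (f (x G.⁻¹)) (f x)
                 (H.trans (H.sym (f-∙ (x G.⁻¹) x)) (H.trans (f-cong (G.inverseˡ x)) f-ε))

module ExtensionFacts {c ℓ : Level} {k m : ℕ} {r : Fin m → Word k} {N : Group c ℓ}
                      (X : Extension r N) where
  open Extension X
  open Group E
  open GroupFacts E
  open Presentation r
  open FreeWords {k}
  open SetoidReasoning setoid
  private module N = Group N
  open GroupMorphisms.IsGroupMonomorphism ι-mono public
    using () renaming (∙-homo to ι-∙; ⁻¹-homo to ι-⁻¹; ε-homo to ι-ε; injective to ι-injective; ⟦⟧-cong to ι-cong)

  eval-++ : ∀ u v → eval (u ++ v) ≈ eval u ∙ eval v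
  eval-++ []      v = sym (identityˡ _)
  eval-++ (x ∷ u) v = trans (∙-congˡ (eval-++ u v)) (sym (assoc _ _ _))

  evalLetter-invLetter : ∀ x → evalLetter (invLetter x) ≈ evalLetter x ⁻¹
  evalLetter-invLetter (i , true)  = refl
  evalLetter-invLetter (i , false) = sym (⁻¹-involutive _)

  eval-invW : ∀ w → eval (invW w) ≈ eval w ⁻¹
  eval-invW [] = sym ε⁻¹≈ε
  eval-invW (x ∷ w) = begin
    eval (invW (x ∷ w))                            ≡⟨ ≡.cong eval (invW-∷ x w) ⟩
    eval (invW w ++ [ invLetter x ])               ≈⟨ eval-++ (invW w) _ ⟩
    eval (invW w) ∙ (evalLetter (invLetter x) ∙ ε) ≈⟨ ∙-cong (eval-invW w) (trans (identityʳ _) (evalLetter-invLetter x)) ⟩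
    eval w ⁻¹ ∙ evalLetter x ⁻¹                    ≈⟨ ⁻¹-anti-homo-∙ _ _ ⟨
    (evalLetter x ∙ eval w) ⁻¹                     ∎

  π-cong′ : ∀ {x y} → x ≈ y → π x ≈ᴳ π y
  π-cong′ h = coset-eq (π-cong h)

  π-∙ : ∀ x y → π (x ∙ y) ≈ᴳ π x ++ π y
  π-∙ x y = coset-eq (π-hom x y)

  π-ε : π ε ≈ᴳ []
  π-ε = coset-eq (Equivalence.from (π-kernel ε) (N.ε , ι-ε))

  π-⁻¹ : ∀ x → π (x ⁻¹) ≈ᴳ invW (π x)
  π-⁻¹ x = ≈ᴳ-moveʳ (≈ᴳ-trans (≈ᴳ-sym (π-∙ (x ⁻¹) x)) (≈ᴳ-trans (π-cong′ (inverseˡ x)) π-ε))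

  π-evalLetter : ∀ x → π (evalLetter x) ≈ᴳ [ x ]
  π-evalLetter (i , true)  = coset-eq (lift-proj i)
  π-evalLetter (i , false) = ≈ᴳ-trans (π-⁻¹ (lift i)) (≈ᴳ-invW {π (lift i)} {[ (i , true) ]} (coset-eq (lift-proj i)))

  π-eval : ∀ w → π (eval w) ≈ᴳ w
  π-eval []      = π-ε
  π-eval (x ∷ w) = ≈ᴳ-trans (π-∙ _ _) (≈ᴳ-++ (π-evalLetter x) (π-eval w))

  -- Normal form: every x ∈ E is ι(a) · w(ŝ) for w = π x, because x · w(ŝ)⁻¹ lies in ker π = ι(N).
  normalForm : ∀ x → Σ N.Carrier λ a → x ≈ ι a ∙ eval (π x)
  normalForm x = a , sym (trans (∙-congʳ ιa≈) (//-rightDividesˡ (eval (π x)) x))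
    where
      inKernel : π (x ∙ eval (π x) ⁻¹) ≈ᴳ []
      inKernel = ≈ᴳ-trans (π-∙ _ _)
        (≈ᴳ-trans (≈ᴳ-congˡ (π x) (≈ᴳ-trans (π-⁻¹ _) (≈ᴳ-invW (π-eval (π x)))))
                  (~⇒≈ᴳ (invW-inverseʳ (π x))))
      preimage : ∃ λ a → ι a ≈ x ∙ eval (π x) ⁻¹
      preimage = Equivalence.to (π-kernel _) (relator inKernel)
      a = proj₁ preimage
      ιa≈ = proj₂ preimage

  φ-domain : ∀ {a u} → φ-graph u a → InR r u
  φ-domain {a} {u} h = ≈ᴳ-[]⇒InR (≈ᴳ-trans (≈ᴳ-sym (π-eval u))
    (≈ᴳ-trans (≈ᴳ-sym (π-cong′ h)) (coset-eq (Equivalence.from (π-kernel (ι a)) (a , refl)))))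

  normalForm-≈⇒φ : ∀ a w b v → ι a ∙ eval w ≈ ι b ∙ eval v → φ-graph (v ++ invW w) (b N.⁻¹ N.∙ a)
  normalForm-≈⇒φ a w b v h = begin
    ι (b N.⁻¹ N.∙ a)    ≈⟨ trans (ι-∙ _ _) (∙-congʳ (ι-⁻¹ b)) ⟩
    ι b ⁻¹ ∙ ι a        ≈⟨ cross-divide h ⟩
    eval v ∙ eval w ⁻¹  ≈⟨ trans (eval-++ v (invW w)) (∙-congˡ (eval-invW w)) ⟨
    eval (v ++ invW w)  ∎

  φ⇒normalForm-≈ : ∀ a w b v → φ-graph (v ++ invW w) (b N.⁻¹ N.∙ a) → ι a ∙ eval w ≈ ι b ∙ eval v
  φ⇒normalForm-≈ a w b v h = cross-multiply (begin
    ι b ⁻¹ ∙ ι a        ≈⟨ trans (ι-∙ _ _) (∙-congʳ (ι-⁻¹ b)) ⟨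
    ι (b N.⁻¹ N.∙ a)    ≈⟨ h ⟩
    eval (v ++ invW w)  ≈⟨ trans (eval-++ v (invW w)) (∙-congˡ (eval-invW w)) ⟩
    eval v ∙ eval w ⁻¹  ∎)

  conjugate-in-N : ∀ e b → Σ N.Carrier λ d → Conjugate e (ι b) (ι d)
  conjugate-in-N e b = d , conjugate-by-⁻¹ (conjugate⁻¹-form→ ιd≈)
    where
      d = proj₁ (ι-normal (e ⁻¹) b)
      ιd≈ = proj₂ (ι-normal (e ⁻¹) b)

module Transfer {c ℓ : Level} {k m : ℕ} {r : Fin m → Word k} {N : Group c ℓ}
                (X Y : Extension r N) where
  private
    module X = Extension X
    module Y = Extension Y
    module EX = Group X.E
    module EY = Group Y.E
    module GX = GroupFacts X.E
    module GY = GroupFacts Y.E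
    module FX = ExtensionFacts X
    module FY = ExtensionFacts Y
    module N = Group N

  PhiIncluded : Set _
  PhiIncluded = ∀ w → InR r w → ∀ a → X.φ-graph w a → Y.φ-graph w a

  ActionIncluded : Set _
  ActionIncluded = ∀ i a b → X.act-graph i a b → Y.act-graph i a b

  normalForm-transfer : PhiIncluded → ∀ a w b v →
    X.ι a EX.∙ X.eval w EX.≈ X.ι b EX.∙ X.eval v → Y.ι a EY.∙ Y.eval w EY.≈ Y.ι b EY.∙ Y.eval v
  normalForm-transfer φ⊆ a w b v h =
    FY.φ⇒normalForm-≈ a w b v (φ⊆ (v ++ invW w) (FX.φ-domain φX) _ φX)
    where
      φX : X.φ-graph (v ++ invW w) (b N.⁻¹ N.∙ a)
      φX = FX.normalForm-≈⇒φ a w b v h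

  letter-conjugate-transfer : ActionIncluded → ∀ x {b c} →
    GX.Conjugate (X.evalLetter x) (X.ι b) (X.ι c) → GY.Conjugate (Y.evalLetter x) (Y.ι b) (Y.ι c)
  letter-conjugate-transfer act⊆ (i , true) h =
    GY.conjugate⁻¹-form→ (act⊆ i _ _ (GX.conjugate⁻¹-form← h))
  letter-conjugate-transfer act⊆ (i , false) h =
    GY.conjugate-⁻¹ (GY.conjugate⁻¹-form→ (act⊆ i _ _ (GX.conjugate⁻¹-form← (GX.conjugate-by-⁻¹ h))))

  conjugate-transfer : ActionIncluded → ∀ w {b c} →
    GX.Conjugate (X.eval w) (X.ι b) (X.ι c) → GY.Conjugate (Y.eval w) (Y.ι b) (Y.ι c)
  conjugate-transfer act⊆ [] h =
    GY.≈⇒conjugate-ε (FY.ι-cong (FX.ι-injective (GX.conjugate-ε⇒≈ h)))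
  conjugate-transfer act⊆ (x ∷ w) {b} h = GY.conjugate-∙
      (letter-conjugate-transfer act⊆ x (GX.conjugate-splitˡ h (proj₂ inner)))
      (conjugate-transfer act⊆ w (proj₂ inner))
    where inner = FX.conjugate-in-N (X.eval w) b

module Isomorphism {c ℓ : Level} {k m : ℕ} {r : Fin m → Word k} {N : Group c ℓ}
                   (X₁ X₂ : Extension r N) (samePhi : SamePhi X₁ X₂) (sameAction : SameAction X₁ X₂) where
  private
    module X₁ = Extension X₁
    module X₂ = Extension X₂
    module E₁ = Group X₁.E
    module E₂ = Group X₂.E
    module G₁ = GroupFacts X₁.E
    module G₂ = GroupFacts X₂.E
    module F₁ = ExtensionFacts X₁
    module F₂ = ExtensionFacts X₂
    module T₁₂ = Transfer X₁ X₂
    module T₂₁ = Transfer X₂ X₁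
    module N = Group N
    open SetoidReasoning E₂.setoid

  φ₁⊆φ₂ : T₁₂.PhiIncluded
  φ₁⊆φ₂ w w∈R a = Equivalence.to (samePhi w w∈R a)

  φ₂⊆φ₁ : T₂₁.PhiIncluded
  φ₂⊆φ₁ w w∈R a = Equivalence.from (samePhi w w∈R a)

  act₁⊆act₂ : T₁₂.ActionIncluded
  act₁⊆act₂ i a b = Equivalence.to (sameAction i a b)

  coord : E₁.Carrier → N.Carrier
  coord x = proj₁ (F₁.normalForm x)

  g : E₁.Carrier → E₂.Carrier
  g x = X₂.ι (coord x) E₂.∙ X₂.eval (X₁.π x)

  g-spec : ∀ {x} a w → x E₁.≈ X₁.ι a E₁.∙ X₁.eval w → g x E₂.≈ X₂.ι a E₂.∙ X₂.eval w
  g-spec {x} a w h = T₁₂.normalForm-transfer φ₁⊆φ₂ (coord x) (X₁.π x) a w (E₁.trans (E₁.sym (proj₂ (F₁.normalForm x))) h)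

  g-cong : ∀ {x y} → x E₁.≈ y → g x E₂.≈ g y
  g-cong {y = y} h = g-spec (coord y) (X₁.π y) (E₁.trans h (proj₂ (F₁.normalForm y)))

  g-injective : ∀ {x y} → g x E₂.≈ g y → x E₁.≈ y
  g-injective {x} {y} h = E₁.trans (proj₂ (F₁.normalForm x))
    (E₁.trans (T₂₁.normalForm-transfer φ₂⊆φ₁ (coord x) (X₁.π x) (coord y) (X₁.π y) h) (E₁.sym (proj₂ (F₁.normalForm y))))

  -- With ι(d) = u(ŝ) ι(b) u(ŝ)⁻¹, the product ι(a)u(ŝ) · ι(b)v(ŝ) is ι(a d)(u v)(ŝ)
  -- in both extensions, d being the same element of N since the actions agree.
  g-∙ : ∀ x y → g (x E₁.∙ y) E₂.≈ g x E₂.∙ g y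
  g-∙ x y = begin
    g (x E₁.∙ y)                          ≈⟨ g-spec (a N.∙ d) (u ++ v) xy≈ ⟩
    X₂.ι (a N.∙ d) E₂.∙ X₂.eval (u ++ v)  ≈⟨ E₂.∙-cong (F₂.ι-∙ a d) (F₂.eval-++ u v) ⟩
    X₂.ι a E₂.∙ X₂.ι d E₂.∙ (X₂.eval u E₂.∙ X₂.eval v)
                                          ≈⟨ G₂.conjugate-slide _ _ (T₁₂.conjugate-transfer act₁⊆act₂ u ιd≈) ⟨
    g x E₂.∙ g y                          ∎
    where
      a = coord x
      b = coord y
      u = X₁.π x
      v = X₁.π y
      d = proj₁ (F₁.conjugate-in-N (X₁.eval u) b)
      ιd≈ = proj₂ (F₁.conjugate-in-N (X₁.eval u) b)
      xy≈ : x E₁.∙ y E₁.≈ X₁.ι (a N.∙ d) E₁.∙ X₁.eval (u ++ v)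
      xy≈ = E₁.trans (E₁.∙-cong (proj₂ (F₁.normalForm x)) (proj₂ (F₁.normalForm y)))
              (E₁.trans (G₁.conjugate-slide _ _ ιd≈)
                (E₁.sym (E₁.∙-cong (F₁.ι-∙ a d) (F₁.eval-++ u v))))

  g-surjective : ∀ y → ∃ λ x → ∀ {z} → z E₁.≈ x → g z E₂.≈ y
  g-surjective y = X₁.ι a E₁.∙ X₁.eval (X₂.π y) ,
                   λ h → E₂.trans (g-spec a (X₂.π y) h) (E₂.sym (proj₂ (F₂.normalForm y)))
    where a = proj₁ (F₂.normalForm y)

  g-isomorphism : GroupMorphisms.IsGroupIsomorphism E₁.rawGroup E₂.rawGroup g
  g-isomorphism = record
    { isGroupMonomorphism = record
      { isGroupHomomorphism = multiplicative⇒isGroupHomomorphism X₁.E X₂.E g g-cong g-∙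
      ; injective = g-injective }
    ; surjective = g-surjective }

  g-fixes-N : ∀ a → g (X₁.ι a) E₂.≈ X₂.ι a
  g-fixes-N a = E₂.trans (g-spec a [] (E₁.sym (E₁.identityʳ _))) (E₂.identityʳ _)

  g-fixes-lifts : ∀ i → g (X₁.lift i) E₂.≈ X₂.lift i
  g-fixes-lifts i = E₂.trans (g-spec N.ε [ (i , true) ] ŝ≈) (E₂.trans (E₂.∙-congʳ F₂.ι-ε)
                      (E₂.trans (E₂.identityˡ _) (E₂.identityʳ _)))
    where
      ŝ≈ : X₁.lift i E₁.≈ X₁.ι N.ε E₁.∙ (X₁.lift i E₁.∙ E₁.ε)
      ŝ≈ = E₁.sym (E₁.trans (E₁.∙-congʳ F₁.ι-ε) (E₁.trans (E₁.identityˡ _) (E₁.identityʳ _)))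

  iso : IsoFixingNAndLifts X₁ X₂
  iso = g , g-isomorphism , g-fixes-N , g-fixes-lifts

module _ {c ℓ : Level} {k m : ℕ} {r : Fin m → Word k} {N : Group c ℓ}
         (X₁ X₂ : Extension r N) where
  private
    module X₁ = Extension X₁
    module X₂ = Extension X₂
    module E₁ = Group X₁.E
    module E₂ = Group X₂.E

  iso⇒samePhi : IsoFixingNAndLifts X₁ X₂ → SamePhi X₁ X₂
  iso⇒samePhi (g , g-iso , g-fixes-N , g-fixes-lifts) w _ a = mk⇔ φ₁⇒φ₂ φ₂⇒φ₁
    where
      open GroupMorphisms.IsGroupIsomorphism g-iso

      g-eval : ∀ w → g (X₁.eval w) E₂.≈ X₂.eval w
      g-eval [] = ε-homo
      g-eval ((i , true) ∷ w) = E₂.trans (∙-homo _ _) (E₂.∙-cong (g-fixes-lifts i) (g-eval w))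
      g-eval ((i , false) ∷ w) = E₂.trans (∙-homo _ _)
        (E₂.∙-cong (E₂.trans (⁻¹-homo _) (E₂.⁻¹-cong (g-fixes-lifts i))) (g-eval w))

      φ₁⇒φ₂ : X₁.φ-graph w a → X₂.φ-graph w a
      φ₁⇒φ₂ h = E₂.trans (E₂.sym (g-fixes-N a)) (E₂.trans (⟦⟧-cong h) (g-eval w))

      φ₂⇒φ₁ : X₂.φ-graph w a → X₁.φ-graph w a
      φ₂⇒φ₁ h = injective (E₂.trans (g-fixes-N a) (E₂.trans h (E₂.sym (g-eval w))))

mainTheorem16 : ∀ {c ℓ : Level} {k m : ℕ} (r : Fin m → Word k) (N : Group c ℓ)
                  (X₁ X₂ : Extension r N) →
                  SameAction X₁ X₂ →
                  (SamePhi X₁ X₂ ⇔ IsoFixingNAndLifts X₁ X₂)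
mainTheorem16 r N X₁ X₂ sameAction =
  mk⇔ (λ samePhi → Isomorphism.iso X₁ X₂ samePhi sameAction) (iso⇒samePhi X₁ X₂)
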